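{- Let $G$ be a symmetric connected graph of order $n\geq 3$, let $G_1,G_2$ be disjoint copies of $G$ with $A=V(G_1)$, $B=V(G_2)$, and let $g:A\to B$ be any function. Then $1\leq fix(G)+fix(F_G)\leq 3n-4$. Both bounds are sharp (each is attained for some such $G$ and $g$).
   Context: All graphs are finite and simple. A set $S\subseteq V(H)$ is a fixing set of a graph $H$ if the only automorphism of $H$ fixing every vertex of $S$ is the identity; $fix(H)$ is the minimum cardinality of a fixing set of $H$. A connected graph $G$ is called symmetric if $fix(G)\neq 0$. Functigraph: for disjoint copies $G_1,G_2$ of $G$, $A=V(G_1)$, $B=V(G_2)$ and a function $g:A\to B$, $F_G$ is the graph with vertex set $A\cup B$ and edge set $E(G_1)\cup E(G_2)\cup\{uv:u\in A,\ v=g(u)\}$. -}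

module Defs where

open import Data.Nat using (ℕ; zero; suc; _+_; _≤_)
open import Data.Bool using (Bool; true; false)
open import Data.Fin using (Fin; splitAt; _≟_)
open import Data.Fin.Subset using (Subset; _∈_; ∣_∣)
open import Data.Fin.Permutation using (Permutation′; _⟨$⟩ʳ_)
open import Data.Sum using (_⊎_; inj₁; inj₂)
open import Data.Product using (Σ; _×_; _,_)
open import Relation.Nullary.Decidable using (⌊_⌋)
open import Relation.Binary.PropositionalEquality using (_≡_; refl)
open import Relation.Nullary using (¬_)

record Graph (n : ℕ) : Set where
  field
    adj        : Fin n → Fin n → Bool
    adj-sym    : ∀ u v → adj u v ≡ adj v u
    adj-irrefl : ∀ v → adj v v ≡ false
open Graph public

data Reach {n : ℕ} (H : Graph n) : Fin n → Fin n → Set where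
  here : ∀ {u} → Reach H u u
  step : ∀ {u v w} → adj H u v ≡ true → Reach H v w → Reach H u w

Connected : ∀ {n} → Graph n → Set
Connected H = ∀ u v → Reach H u v

IsAutomorphism : ∀ {n} → Graph n → Permutation′ n → Set
IsAutomorphism H σ = ∀ u v → adj H u v ≡ adj H (σ ⟨$⟩ʳ u) (σ ⟨$⟩ʳ v)

IsFixingSet : ∀ {n} → Graph n → Subset n → Set
IsFixingSet {n} H S =
  (σ : Permutation′ n) → IsAutomorphism H σ →
  (∀ v → v ∈ S → σ ⟨$⟩ʳ v ≡ v) → ∀ v → σ ⟨$⟩ʳ v ≡ v

IsFixNumber : ∀ {n} → Graph n → ℕ → Set
IsFixNumber {n} H k =
  Σ (Subset n) (λ S → IsFixingSet H S × ∣ S ∣ ≡ k)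
  × (∀ S → IsFixingSet H S → k ≤ ∣ S ∣)

Symmetric : ∀ {n} → Graph n → Set
Symmetric H = ∀ k → IsFixNumber H k → ¬ (k ≡ 0)

-- Functigraph: vertices Fin (n + n); the first n (inj₁ a) form A = V(G₁),
-- the last n (inj₂ b) form B = V(G₂); g : A → B.
sAdj : ∀ {n} → Graph n → (Fin n → Fin n) → Fin n ⊎ Fin n → Fin n ⊎ Fin n → Bool
sAdj G g (inj₁ a) (inj₁ a′) = adj G a a′
sAdj G g (inj₂ b) (inj₂ b′) = adj G b b′
sAdj G g (inj₁ a) (inj₂ b)  = ⌊ g a ≟ b ⌋
sAdj G g (inj₂ b) (inj₁ a)  = ⌊ g a ≟ b ⌋

sAdj-sym : ∀ {n} (G : Graph n) g x y → sAdj G g x y ≡ sAdj G g y x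
sAdj-sym G g (inj₁ a) (inj₁ a′) = adj-sym G a a′
sAdj-sym G g (inj₂ b) (inj₂ b′) = adj-sym G b b′
sAdj-sym G g (inj₁ a) (inj₂ b)  = refl
sAdj-sym G g (inj₂ b) (inj₁ a)  = refl

sAdj-irrefl : ∀ {n} (G : Graph n) g x → sAdj G g x x ≡ false
sAdj-irrefl G g (inj₁ a) = adj-irrefl G a
sAdj-irrefl G g (inj₂ b) = adj-irrefl G b

functigraph : ∀ {n} → Graph n → (Fin n → Fin n) → Graph (n + n)
functigraph {n} G g = record
  { adj        = λ x y → sAdj G g (splitAt n x) (splitAt n y)
  ; adj-sym    = λ x y → sAdj-sym G g (splitAt n x) (splitAt n y)
  ; adj-irrefl = λ x → sAdj-irrefl G g (splitAt n x)
  }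

-- A set S is fixing as soon as any two vertices outside S are told apart by
-- their adjacency to some vertex of S; all fixing sets below are complements
-- of two or three vertices chosen that way. For the upper bound, if G is not
-- complete, the first step u → p of a walk between non-adjacent u and v
-- leaves {u, v} or {u, p} separated, so fix(G) ≤ n − 2, while in F_G the
-- copies of g(a) and of any other b ∈ B are separated by a, so
-- fix(F_G) ≤ 2n − 2. If G = K_n then fix(G) = n − 1, but {a, g(a), b} is
-- separated in F_G for a suitable b ∈ B, so fix(F_G) ≤ 2n − 3. The lower
-- bound is fix(G) ≥ 1. Sharpness: P₃ with g = (0, 0, 1) gives 1 + 0, its
-- functigraph being rigid, and K₃ with constant g gives 2 + 3 = 3·3 − 4.
module Submission where

open import Defs
open import Data.Bool using (Bool; true; false; not; if_then_else_)
import Data.Bool.Properties as Bool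
open import Data.Empty using (⊥-elim)
open import Data.Fin using (Fin; zero; suc; splitAt; _≟_; _↑ˡ_; _↑ʳ_)
open import Data.Fin.Patterns using (0F; 1F; 2F; 3F; 4F; 5F)
open import Data.Fin.Permutation using (Permutation′; _⟨$⟩ʳ_; transpose)
open import Data.Fin.Properties using (all?; any?; splitAt-↑ˡ; splitAt-↑ʳ; ↑ˡ-injective; ↑ʳ-injective)
open import Data.Fin.Subset using (Subset; _∈_; _∉_; ∣_∣; ⊤; ⊥; _-_)
open import Data.Fin.Subset.Properties
  using (_∈?_; ∈⊤; x∈p∧x∉q⇒x∈p─q; x≢y⇒x∉⁅y⁆; x∈p⇒∣p-x∣<∣p∣; ∣⊤∣≡n; anySubset?)
open import Data.List using (List; []; _∷_; length; allFin)
open import Data.List.Membership.Propositional using () renaming (_∈_ to _∈ₗ_; _∉_ to _∉ₗ_)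
import Data.List.Membership.DecPropositional as DecMembership
open import Data.List.Membership.Propositional.Properties using (∈-allFin)
open import Data.List.Relation.Unary.All as All using (All; []; _∷_)
open import Data.List.Relation.Unary.All.Properties using (All¬⇒¬Any)
open import Data.List.Relation.Unary.AllPairs using (AllPairs; []; _∷_)
open import Data.List.Relation.Unary.Any as Any using (Any; here; there)
import Data.Nat as ℕ
open import Data.Nat using (ℕ; suc; _+_; _*_; _∸_; _≤_; _<_; _≤?_; _<?_; z≤n; s≤s)
open import Data.Nat.Properties
  using (≤-trans; ≤-reflexive; ≤-antisym; +-monoʳ-≤; +-mono-≤; +-suc; ≰⇒>; n≢0⇒n>0; m≤m+n;
         m+n≤o⇒m≤o∸n; 0≢1+n; +-0-commutativeMonoid; module ≤-Reasoning)
open import Data.Nat.Tactic.RingSolver using (solve-∀)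
open import Algebra.Properties.CommutativeMonoid.Sum +-0-commutativeMonoid using (sum; sum-cong-≗; sum-permute)
open import Data.Product using (Σ; ∃-syntax; _×_; _,_; proj₁; proj₂)
open import Data.Sum using (_⊎_; inj₁; inj₂)
open import Function using (_∘_; Injection)
open import Function.Properties.Inverse using (↔⇒↣)
open import Relation.Nullary using (¬_; Dec; yes; no; ¬?)
open import Relation.Nullary.Decidable
  using (⌊_⌋; True; toWitness; _×-dec_; _→-dec_; from-yes; decidable-stable; dec-true; dec-false; isYes≗does)
open import Relation.Binary.PropositionalEquality using (_≡_; _≢_; refl; sym; trans; cong; cong₂; module ≡-Reasoning)

private
  variable
    m : ℕ
    H : Graph m

isYes-true : ∀ {A : Set} (a? : Dec A) → A → ⌊ a? ⌋ ≡ true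
isYes-true a? a = trans (isYes≗does a?) (dec-true a? a)

isYes-false : ∀ {A : Set} (a? : Dec A) → ¬ A → ⌊ a? ⌋ ≡ false
isYes-false a? ¬a = trans (isYes≗does a?) (dec-false a? ¬a)

adjacent⇒≢ : ∀ {u v} → adj H u v ≡ true → u ≢ v
adjacent⇒≢ {H = H} {u} u~u refl with trans (sym u~u) (adj-irrefl H u)
... | ()

permutation-injective : (σ : Permutation′ m) {u v : Fin m} → σ ⟨$⟩ʳ u ≡ σ ⟨$⟩ʳ v → u ≡ v
permutation-injective σ = Injection.injective (↔⇒↣ σ)

fixNumber-unique : ∀ {k k′} → IsFixNumber H k → IsFixNumber H k′ → k ≡ k′
fixNumber-unique ((S , fixing , refl) , minimal) ((S′ , fixing′ , refl) , minimal′) =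
  ≤-antisym (minimal S′ fixing′) (minimal′ S fixing)

fixNumber≢0⇒symmetric : ∀ {k} → IsFixNumber H (suc k) → Symmetric H
fixNumber≢0⇒symmetric {H = H} fix k′ fix′ k′≡0 =
  0≢1+n (trans (sym k′≡0) (fixNumber-unique {H = H} fix′ fix))

fixNumber≤ : ∀ {k j N} → IsFixNumber H k → ∃[ S ] IsFixingSet H S × j + ∣ S ∣ ≤ N → j + k ≤ N
fixNumber≤ {j = j} (_ , minimal) (S , fixing , bound) = ≤-trans (+-monoʳ-≤ j (minimal S fixing)) bound

-- Separating sets

Separates : Graph m → Fin m → Fin m → Fin m → Set
Separates H w u v = adj H u w ≢ adj H v w

separates : ∀ {u v w} → adj H u w ≡ true → adj H v w ≡ false → Separates H w u v
separates u~w v≁w u~w≡v~w with trans (sym u~w) (trans u~w≡v~w v≁w)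
... | ()

SeparatingSet : Graph m → Subset m → Set
SeparatingSet H S = ∀ u v → u ∉ S → v ∉ S → u ≢ v → ∃[ w ] w ∈ S × Separates H w u v

separatingSet? : (H : Graph m) (S : Subset m) → Dec (SeparatingSet H S)
separatingSet? H S = all? λ u → all? λ v →
  ¬? (u ∈? S) →-dec (¬? (v ∈? S) →-dec (¬? (u ≟ v) →-dec
    any? λ w → (w ∈? S) ×-dec ¬? (adj H u w Bool.≟ adj H v w)))

-- An automorphism fixing S moves v only to a vertex outside S with the same
-- adjacencies to S, and there is none but v.
separatingSet⇒isFixingSet : ∀ {S} → SeparatingSet H S → IsFixingSet H S
separatingSet⇒isFixingSet {H = H} {S} separating σ aut fixesS v with v ∈? S
... | yes v∈S = fixesS v v∈S
... | no v∉S with σ ⟨$⟩ʳ v ∈? S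
...   | yes σv∈S = permutation-injective σ (fixesS _ σv∈S)
...   | no σv∉S with σ ⟨$⟩ʳ v ≟ v
...     | yes σv≡v = σv≡v
...     | no σv≢v with separating v (σ ⟨$⟩ʳ v) v∉S σv∉S (σv≢v ∘ sym)
...       | w , w∈S , separated =
  ⊥-elim (separated (trans (aut v w) (cong (adj H (σ ⟨$⟩ʳ v)) (fixesS w w∈S))))

allBut : List (Fin m) → Subset m
allBut []       = ⊤
allBut (x ∷ xs) = allBut xs - x

∈-allBut : ∀ {v} {xs : List (Fin m)} → v ∉ₗ xs → v ∈ allBut xs
∈-allBut {xs = []}     _   = ∈⊤
∈-allBut {xs = x ∷ xs} v∉ = x∈p∧x∉q⇒x∈p─q (∈-allBut (v∉ ∘ there)) (x≢y⇒x∉⁅y⁆ (v∉ ∘ here))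

∉-allBut : ∀ {v} {xs : List (Fin m)} → v ∉ allBut xs → v ∈ₗ xs
∉-allBut {v = v} {xs} v∉ with DecMembership._∈?_ _≟_ v xs
... | yes v∈ₗ = v∈ₗ
... | no v∉ₗ = ⊥-elim (v∉ (∈-allBut v∉ₗ))

length+∣allBut∣≤ : {xs : List (Fin m)} → AllPairs _≢_ xs → length xs + ∣ allBut xs ∣ ≤ m
length+∣allBut∣≤ {m} [] = ≤-reflexive (∣⊤∣≡n m)
length+∣allBut∣≤ {m} {x ∷ xs} (x≢xs ∷ distinct) = begin
  suc (length xs + ∣ allBut xs - x ∣) ≡⟨ +-suc (length xs) _ ⟨
  length xs + suc ∣ allBut xs - x ∣   ≤⟨ +-monoʳ-≤ (length xs) (x∈p⇒∣p-x∣<∣p∣ x∈allBut-xs) ⟩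
  length xs + ∣ allBut xs ∣           ≤⟨ length+∣allBut∣≤ distinct ⟩
  m                                   ∎
  where
  open ≤-Reasoning
  x∈allBut-xs = ∈-allBut (All¬⇒¬Any x≢xs)

Separator : Graph m → List (Fin m) → Fin m → Fin m → Set
Separator {m} H xs u v = ∃[ w ] All (w ≢_) xs × Separates H w u v

separator-sym : ∀ {xs u v} → Separator H xs u v → Separator H xs v u
separator-sym (w , w∉xs , separated) = w , w∉xs , separated ∘ sym

allPairs-∈ : ∀ {R : Fin m → Fin m → Set} → (∀ {a b} → R a b → R b a) →
             ∀ {xs u v} → AllPairs R xs → u ∈ₗ xs → v ∈ₗ xs → u ≢ v → R u v
allPairs-∈ _   (_ ∷ _)  (here refl) (here refl) u≢v = ⊥-elim (u≢v refl)
allPairs-∈ _   (r ∷ _)  (here refl) (there v∈) _   = All.lookup r v∈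
allPairs-∈ rsym (r ∷ _)  (there u∈) (here refl) _  = rsym (All.lookup r u∈)
allPairs-∈ rsym (_ ∷ rs) (there u∈) (there v∈) u≢v = allPairs-∈ rsym rs u∈ v∈ u≢v

allBut-isFixingSet : {xs : List (Fin m)} → AllPairs (Separator H xs) xs → IsFixingSet H (allBut xs)
allBut-isFixingSet {H = H} {xs} separators = separatingSet⇒isFixingSet {H = H} λ u v u∉ v∉ u≢v →
  let w , w∉xs , separated = allPairs-∈ (separator-sym {H = H}) separators (∉-allBut u∉) (∉-allBut v∉) u≢v
  in  w , ∈-allBut (All¬⇒¬Any w∉xs) , separated

allBut₁-isFixingSet : (x : Fin m) → IsFixingSet H (allBut (x ∷ []))
allBut₁-isFixingSet {H = H} x = allBut-isFixingSet {H = H} ([] ∷ [])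

fixingSet-missing₁ : {H : Graph m} (x : Fin m) → ∃[ S ] IsFixingSet H S × 1 + ∣ S ∣ ≤ m
fixingSet-missing₁ {H = H} x = allBut (x ∷ []) , allBut₁-isFixingSet {H = H} x , length+∣allBut∣≤ ([] ∷ [])

fixingSet-missing₂ : {H : Graph m} {x y : Fin m} → x ≢ y → Separator H (x ∷ y ∷ []) x y →
                     ∃[ S ] IsFixingSet H S × 2 + ∣ S ∣ ≤ m
fixingSet-missing₂ {H = H} {x} {y} x≢y x|y =
  allBut (x ∷ y ∷ []) ,
  allBut-isFixingSet {H = H} ((x|y ∷ []) ∷ [] ∷ []) ,
  length+∣allBut∣≤ ((x≢y ∷ []) ∷ [] ∷ [])

fixingSet-missing₃ : {H : Graph m} {x y z : Fin m} → x ≢ y → x ≢ z → y ≢ z →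
                    let xs = x ∷ y ∷ z ∷ [] in Separator H xs x y → Separator H xs x z → Separator H xs y z →
                    ∃[ S ] IsFixingSet H S × 3 + ∣ S ∣ ≤ m
fixingSet-missing₃ {H = H} {x} {y} {z} x≢y x≢z y≢z x|y x|z y|z =
  allBut (x ∷ y ∷ z ∷ []) ,
  allBut-isFixingSet {H = H} ((x|y ∷ x|z ∷ []) ∷ (y|z ∷ []) ∷ [] ∷ []) ,
  length+∣allBut∣≤ ((x≢y ∷ x≢z ∷ []) ∷ (y≢z ∷ []) ∷ [] ∷ [])

-- Degree and individualisation

degree : Graph m → Fin m → ℕ
degree H v = sum (λ w → if adj H v w then 1 else 0)

degree-automorphism : ∀ {σ} → IsAutomorphism H σ → ∀ v → degree H (σ ⟨$⟩ʳ v) ≡ degree H v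
degree-automorphism {H = H} {σ} aut v = begin
  degree H (σ ⟨$⟩ʳ v)                                    ≡⟨ sum-permute _ σ ⟩
  sum (λ w → indicator (adj H (σ ⟨$⟩ʳ v) (σ ⟨$⟩ʳ w)))    ≡⟨ sum-cong-≗ (λ w → cong indicator (aut v w)) ⟨
  degree H v                                             ∎
  where
  open ≡-Reasoning
  indicator : Bool → ℕ
  indicator b = if b then 1 else 0

DeterminedBy : Graph m → List (Fin m) → Fin m → Set
DeterminedBy H ws v = ∀ u → degree H u ≡ degree H v → All (λ w → adj H u w ≡ adj H v w) ws → u ≡ v

determinedBy? : (H : Graph m) (ws : List (Fin m)) (v : Fin m) → Dec (DeterminedBy H ws v)
determinedBy? H ws v = all? λ u →
  (degree H u ℕ.≟ degree H v) →-dec (All.all? (λ w → adj H u w Bool.≟ adj H v w) ws →-dec (u ≟ v))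

data Individualises (H : Graph m) : List (Fin m) → Set where
  []  : Individualises H []
  _∷_ : ∀ {v vs} → DeterminedBy H vs v → Individualises H vs → Individualises H (v ∷ vs)

individualises? : (H : Graph m) (vs : List (Fin m)) → Dec (Individualises H vs)
individualises? H []       = yes []
individualises? H (v ∷ vs) with determinedBy? H vs v | individualises? H vs
... | yes determined | yes rest = yes (determined ∷ rest)
... | no undetermined | _      = no λ { (determined ∷ _) → undetermined determined }
... | _ | no ¬rest             = no λ { (_ ∷ rest) → ¬rest rest }

determinedBy-fixed : ∀ {σ ws v} → IsAutomorphism H σ → All (λ w → σ ⟨$⟩ʳ w ≡ w) ws →
                     DeterminedBy H ws v → σ ⟨$⟩ʳ v ≡ v
determinedBy-fixed {H = H} {σ} {v = v} aut fixed determined =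
  determined (σ ⟨$⟩ʳ v) (degree-automorphism {H = H} {σ} aut v)
    (All.map (λ {w} σw≡w → trans (cong (adj H (σ ⟨$⟩ʳ v)) (sym σw≡w)) (sym (aut v w))) fixed)

individualises-fixed : ∀ {σ vs} → IsAutomorphism H σ → Individualises H vs → All (λ w → σ ⟨$⟩ʳ w ≡ w) vs
individualises-fixed aut []                   = []
individualises-fixed {H = H} {σ} aut (determined ∷ rest) =
  determinedBy-fixed {H = H} {σ} aut fixed determined ∷ fixed
  where fixed = individualises-fixed {H = H} {σ} aut rest

individualises⇒isFixingSet : ∀ {vs} → Individualises H vs → (∀ v → v ∈ₗ vs) → ∀ S → IsFixingSet H S
individualises⇒isFixingSet {H = H} individualised covers S σ aut _ v =
  All.lookup (individualises-fixed {H = H} {σ} aut individualised) (covers v)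

-- Lower bounds from automorphisms

FixesPointwise : Permutation′ m → Subset m → Set
FixesPointwise σ S = ∀ v → v ∈ S → σ ⟨$⟩ʳ v ≡ v

Moves : Permutation′ m → Set
Moves {m} σ = ∃[ v ] σ ⟨$⟩ʳ v ≢ v

isAutomorphism? : (H : Graph m) (σ : Permutation′ m) → Dec (IsAutomorphism H σ)
isAutomorphism? H σ = all? λ u → all? λ v → adj H u v Bool.≟ adj H (σ ⟨$⟩ʳ u) (σ ⟨$⟩ʳ v)

fixesPointwise? : (σ : Permutation′ m) (S : Subset m) → Dec (FixesPointwise σ S)
fixesPointwise? σ S = all? λ v → (v ∈? S) →-dec (σ ⟨$⟩ʳ v ≟ v)

moves? : (σ : Permutation′ m) → Dec (Moves σ)
moves? σ = any? λ v → ¬? (σ ⟨$⟩ʳ v ≟ v)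

∀-subset? : {P : Subset m → Set} → (∀ S → Dec (P S)) → Dec (∀ S → P S)
∀-subset? P? with anySubset? (¬? ∘ P?)
... | yes (S , ¬PS) = no λ ∀P → ¬PS (∀P S)
... | no ∄¬P        = yes λ S → decidable-stable (P? S) (∄¬P ∘ (S ,_))

¬isFixingSet : ∀ {σs S} → All (IsAutomorphism H) σs →
               Any (λ σ → FixesPointwise σ S × Moves σ) σs → ¬ IsFixingSet H S
¬isFixingSet {σs = σ ∷ _} (aut ∷ _) (here (fixesS , v , moved)) fixing = moved (fixing σ aut fixesS v)
¬isFixingSet {H = H} (_ ∷ auts)     (there moving)              fixing = ¬isFixingSet {H = H} auts moving fixing

fixingSet-size-≥ : ∀ {k} (σs : List (Permutation′ m)) → All (IsAutomorphism H) σs →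
                   (∀ S → ∣ S ∣ < k → Any (λ σ → FixesPointwise σ S × Moves σ) σs) →
                   ∀ S → IsFixingSet H S → k ≤ ∣ S ∣
fixingSet-size-≥ {H = H} {k} σs auts small⇒moved S fixing with k ≤? ∣ S ∣
... | yes k≤∣S∣ = k≤∣S∣
... | no k≰∣S∣ = ⊥-elim (¬isFixingSet {H = H} {σs} auts (small⇒moved S (≰⇒> k≰∣S∣)) fixing)

smallSetsMoved? : ∀ k (σs : List (Permutation′ m)) →
                  Dec (∀ S → ∣ S ∣ < k → Any (λ σ → FixesPointwise σ S × Moves σ) σs)
smallSetsMoved? k σs = ∀-subset? λ S →
  (∣ S ∣ <? k) →-dec Any.any? (λ σ → fixesPointwise? σ S ×-dec moves? σ) σs

fixingSet-size-≥-by-decision : ∀ {k} (σs : List (Permutation′ m)) →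
                               {True (All.all? (isAutomorphism? H) σs)} → {True (smallSetsMoved? k σs)} →
                               ∀ S → IsFixingSet H S → k ≤ ∣ S ∣
fixingSet-size-≥-by-decision {H = H} {k} σs {auts} {moved} =
  fixingSet-size-≥ {H = H} σs (toWitness auts) (toWitness moved)

dominating⇒connected : (c : Fin m) → (∀ v → v ≢ c → adj H v c ≡ true) → Connected H
dominating⇒connected {H = H} c dominating u v = via-c u (from-c v)
  where
  from-c : ∀ v → Reach H c v
  from-c v with v ≟ c
  ... | yes refl = here
  ... | no v≢c = step (trans (adj-sym H c v) (dominating v v≢c)) here
  via-c : ∀ u → Reach H c v → Reach H u v
  via-c u c⇝v with u ≟ c
  ... | yes refl = c⇝v
  ... | no u≢c = step (dominating u u≢c) c⇝v

isYes-≟-sym : (u v : Fin m) → ⌊ u ≟ v ⌋ ≡ ⌊ v ≟ u ⌋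
isYes-≟-sym u v with u ≟ v | v ≟ u
... | yes _   | yes _   = refl
... | no _    | no _    = refl
... | yes u≡v | no v≢u = ⊥-elim (v≢u (sym u≡v))
... | no u≢v  | yes v≡u = ⊥-elim (u≢v (sym v≡u))

complete : (n : ℕ) → Graph n
complete n = record
  { adj        = λ u v → not ⌊ u ≟ v ⌋
  ; adj-sym    = λ u v → cong not (isYes-≟-sym u v)
  ; adj-irrefl = λ v → cong not (isYes-true (v ≟ v) refl)
  }

complete-adj : ∀ {u v : Fin m} → u ≢ v → adj (complete m) u v ≡ true
complete-adj {u = u} {v} u≢v = cong not (isYes-false (u ≟ v) u≢v)

complete-connected : Connected (complete (suc m))
complete-connected = dominating⇒connected zero λ v → complete-adj

IsComplete : Graph m → Set
IsComplete H = ∀ u v → u ≢ v → adj H u v ≡ true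

complete⊎nonadjacent : (H : Graph m) → IsComplete H ⊎ ∃[ u ] ∃[ v ] u ≢ v × adj H u v ≡ false
complete⊎nonadjacent H with any? (λ u → any? λ v → ¬? (u ≟ v) ×-dec (adj H u v Bool.≟ false))
... | yes (u , v , u≢v , u≁v) = inj₂ (u , v , u≢v , u≁v)
... | no ∄nonadjacent = inj₁ λ u v u≢v → Bool.¬-not λ u≁v → ∄nonadjacent (u , v , u≢v , u≁v)

-- The first step u → p of a walk from u to v separates u from v, or else v separates u from p.
nonadjacent⇒fixingSet-missing₂ : {H : Graph m} → Connected H → ∀ {u v} → u ≢ v → adj H u v ≡ false →
                        ∃[ S ] IsFixingSet H S × 2 + ∣ S ∣ ≤ m
nonadjacent⇒fixingSet-missing₂ {H = H} connected {u} {v} u≢v u≁v = firstStep (connected u v)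
  where
  firstStep : Reach H u v → ∃[ S ] IsFixingSet H S × 2 + ∣ S ∣ ≤ _
  firstStep here = ⊥-elim (u≢v refl)
  firstStep (step {v = p} u~p _) with adj H v p in v~p
  ... | false = fixingSet-missing₂ {H = H} u≢v (p , p≢u ∷ p≢v ∷ [] , separates {H = H} u~p v~p)
    where
    p≢u : p ≢ u
    p≢u = adjacent⇒≢ {H = H} u~p ∘ sym
    p≢v : p ≢ v
    p≢v refl with trans (sym u~p) u≁v
    ... | ()
  ... | true = fixingSet-missing₂ {H = H} (adjacent⇒≢ {H = H} u~p)
                 (v , (u≢v ∘ sym) ∷ adjacent⇒≢ {H = H} v~p ∷ [] ,
                  separates {H = H} (trans (adj-sym H p v) v~p) u≁v ∘ sym)

-- Functigraphs

module Functigraph {n : ℕ} (G : Graph n) (g : Fin n → Fin n) where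

  F : Graph (n + n)
  F = functigraph G g

  inA inB : Fin n → Fin (n + n)
  inA a = a ↑ˡ n
  inB b = n ↑ʳ b

  adj-inA-inB : ∀ a b → adj F (inA a) (inB b) ≡ ⌊ g a ≟ b ⌋
  adj-inA-inB a b = cong₂ (sAdj G g) (splitAt-↑ˡ n a n) (splitAt-↑ʳ n n b)

  adj-inB-inA : ∀ b a → adj F (inB b) (inA a) ≡ ⌊ g a ≟ b ⌋
  adj-inB-inA b a = trans (adj-sym F (inB b) (inA a)) (adj-inA-inB a b)

  adj-inB-inB : ∀ b b′ → adj F (inB b) (inB b′) ≡ adj G b b′
  adj-inB-inB b b′ = cong₂ (sAdj G g) (splitAt-↑ʳ n n b) (splitAt-↑ʳ n n b′)

  inA≢inB : ∀ {a b} → inA a ≢ inB b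
  inA≢inB {a} {b} inAa≡inBb
    with trans (sym (splitAt-↑ˡ n a n)) (trans (cong (splitAt n) inAa≡inBb) (splitAt-↑ʳ n n b))
  ... | ()

  inB≢inA : ∀ {a b} → inB b ≢ inA a
  inB≢inA = inA≢inB ∘ sym

  inA-≢ : ∀ {a a′} → a ≢ a′ → inA a ≢ inA a′
  inA-≢ a≢a′ = a≢a′ ∘ ↑ˡ-injective n _ _

  inB-≢ : ∀ {b b′} → b ≢ b′ → inB b ≢ inB b′
  inB-≢ b≢b′ = b≢b′ ∘ ↑ʳ-injective n _ _

  -- inB (g a) is the only neighbour of inA a in B.
  functigraph-fixingSet-missing₂ : ∀ {a b} → b ≢ g a → ∃[ S ] IsFixingSet F S × 2 + ∣ S ∣ ≤ n + n
  functigraph-fixingSet-missing₂ {a} {b} b≢ga = fixingSet-missing₂ {H = F} (inB-≢ (b≢ga ∘ sym))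
    (inA a , inA≢inB ∷ inA≢inB ∷ [] ,
     separates {H = F} (trans (adj-inB-inA (g a) a) (isYes-true (g a ≟ g a) refl))
                       (trans (adj-inB-inA b a) (isYes-false (g a ≟ b) (b≢ga ∘ sym))))

  separatingPartner : (∀ z z′ → ∃[ w ] w ≢ z × w ≢ z′) → ∀ a₀ a₁ →
                      ∃[ b ] b ≢ g a₀ × Separates F (inA a₁) (inB (g a₀)) (inB b)
  separatingPartner avoid a₀ a₁ with g a₁ ≟ g a₀
  ... | no ga₁≢ga₀ = g a₁ , ga₁≢ga₀ ,
    separates {H = F} (trans (adj-inB-inA (g a₁) a₁) (isYes-true (g a₁ ≟ g a₁) refl))
                      (trans (adj-inB-inA (g a₀) a₁) (isYes-false (g a₁ ≟ g a₀) ga₁≢ga₀)) ∘ sym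
  ... | yes ga₁≡ga₀ with avoid (g a₀) (g a₀)
  ...   | b , b≢ga₀ , _ = b , b≢ga₀ ,
    separates {H = F} (trans (adj-inB-inA (g a₀) a₁) (isYes-true (g a₁ ≟ g a₀) ga₁≡ga₀))
                      (trans (adj-inB-inA b a₁)
                             (isYes-false (g a₁ ≟ b) λ ga₁≡b → b≢ga₀ (trans (sym ga₁≡b) ga₁≡ga₀)))

  -- For complete G, inB w with w ∉ {g a₀, b} is adjacent to inB (g a₀) and inB b but not to inA a₀.
  complete⇒functigraph-fixingSet-missing₃ : IsComplete G → (∀ z z′ → ∃[ w ] w ≢ z × w ≢ z′) →
                                            ∀ {a₀ a₁} → a₀ ≢ a₁ → ∃[ S ] IsFixingSet F S × 3 + ∣ S ∣ ≤ n + n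
  complete⇒functigraph-fixingSet-missing₃ complete avoid {a₀} {a₁} a₀≢a₁ with separatingPartner avoid a₀ a₁
  ... | b , b≢ga₀ , a₁-separates with avoid (g a₀) b
  ...   | w , w≢ga₀ , w≢b =
    fixingSet-missing₃ {H = F} inA≢inB inA≢inB (inB-≢ (b≢ga₀ ∘ sym))
      (inB w , outside , separates {H = F} (adjacent-inB-inB (g a₀) (w≢ga₀ ∘ sym)) inA≁inB ∘ sym)
      (inB w , outside , separates {H = F} (adjacent-inB-inB b (w≢b ∘ sym)) inA≁inB ∘ sym)
      (inA a₁ , inA-≢ (a₀≢a₁ ∘ sym) ∷ inA≢inB ∷ inA≢inB ∷ [] , a₁-separates)
    where
    outside : All (inB w ≢_) (inA a₀ ∷ inB (g a₀) ∷ inB b ∷ [])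
    outside = inB≢inA ∷ inB-≢ w≢ga₀ ∷ inB-≢ w≢b ∷ []
    inA≁inB : adj F (inA a₀) (inB w) ≡ false
    inA≁inB = trans (adj-inA-inB a₀ w) (isYes-false (g a₀ ≟ w) (w≢ga₀ ∘ sym))
    adjacent-inB-inB : ∀ b′ → b′ ≢ w → adj F (inB b′) (inB w) ≡ true
    adjacent-inB-inB b′ b′≢w = trans (adj-inB-inB b′ w) (complete b′ w b′≢w)

avoid₂ : ∀ {c} (z z′ : Fin (3 + c)) → ∃[ w ] w ≢ z × w ≢ z′
avoid₂ zero          zero          = 1F , (λ ()) , (λ ())
avoid₂ zero          (suc zero)    = 2F , (λ ()) , (λ ())
avoid₂ zero          (suc (suc _)) = 1F , (λ ()) , (λ ())
avoid₂ (suc zero)    zero          = 2F , (λ ()) , (λ ())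
avoid₂ (suc zero)    (suc _)       = 0F , (λ ()) , (λ ())
avoid₂ (suc (suc _)) zero          = 1F , (λ ()) , (λ ())
avoid₂ (suc (suc _)) (suc _)       = 0F , (λ ()) , (λ ())

sum≤3n∸4 : ∀ {n i j k₁ k₂} → i + j ≡ 4 → i + k₁ ≤ n → j + k₂ ≤ n + n → k₁ + k₂ ≤ 3 * n ∸ 4
sum≤3n∸4 {n} {i} {j} {k₁} {k₂} i+j≡4 bound₁ bound₂ = m+n≤o⇒m≤o∸n (k₁ + k₂) (begin
  k₁ + k₂ + 4              ≡⟨ cong (k₁ + k₂ +_) i+j≡4 ⟨
  k₁ + k₂ + (i + j)        ≡⟨ regroup k₁ k₂ i j ⟩
  (i + k₁) + (j + k₂)      ≤⟨ +-mono-≤ bound₁ bound₂ ⟩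
  n + (n + n)              ≡⟨ triple n ⟩
  3 * n                    ∎)
  where
  open ≤-Reasoning
  regroup : ∀ a b c d → a + b + (c + d) ≡ (c + a) + (d + b)
  regroup = solve-∀
  triple : ∀ a → a + (a + a) ≡ 3 * a
  triple = solve-∀

fixNumber-sum≤ : ∀ {c k₁ k₂} (G : Graph (3 + c)) (g : Fin (3 + c) → Fin (3 + c)) → Connected G →
                 IsFixNumber G k₁ → IsFixNumber (functigraph G g) k₂ → k₁ + k₂ ≤ 3 * (3 + c) ∸ 4
fixNumber-sum≤ G g connected fix₁ fix₂ with complete⊎nonadjacent G
... | inj₁ complete =
  sum≤3n∸4 {i = 1} refl (fixNumber≤ {H = G} fix₁ (fixingSet-missing₁ {H = G} 0F))
    (fixNumber≤ {H = functigraph G g} fix₂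
      (Functigraph.complete⇒functigraph-fixingSet-missing₃ G g complete avoid₂ {0F} {1F} (λ ())))
... | inj₂ (u , v , u≢v , u≁v) =
  sum≤3n∸4 {i = 2} refl (fixNumber≤ {H = G} fix₁ (nonadjacent⇒fixingSet-missing₂ connected u≢v u≁v))
    (fixNumber≤ {H = functigraph G g} fix₂
      (Functigraph.functigraph-fixingSet-missing₂ G g {0F} (proj₁ (proj₂ (avoid₂ (g 0F) (g 0F))))))

fixNumber-sum-bounds : (n : ℕ) (G : Graph n) (g : Fin n → Fin n) (k₁ k₂ : ℕ) →
                       3 ≤ n → Connected G → Symmetric G →
                       IsFixNumber G k₁ → IsFixNumber (functigraph G g) k₂ →
                       (1 ≤ k₁ + k₂) × (k₁ + k₂ ≤ 3 * n ∸ 4)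
fixNumber-sum-bounds _ G g k₁ k₂ (s≤s (s≤s (s≤s _))) connected symmetric fix₁ fix₂ =
  ≤-trans (n≢0⇒n>0 (symmetric k₁ fix₁)) (m≤m+n k₁ k₂) , fixNumber-sum≤ G g connected fix₁ fix₂

-- Sharpness

path₃ : Graph 3
path₃ = record
  { adj        = adjacent
  ; adj-sym    = from-yes (all? λ u → all? λ v → adjacent u v Bool.≟ adjacent v u)
  ; adj-irrefl = from-yes (all? λ v → adjacent v v Bool.≟ false)
  }
  where
  adjacent : Fin 3 → Fin 3 → Bool
  adjacent 0F 1F = true
  adjacent 1F 0F = true
  adjacent 1F 2F = true
  adjacent 2F 1F = true
  adjacent _  _  = false

path₃-connected : Connected path₃
path₃-connected = dominating⇒connected 1F λ { 0F _ → refl ; 1F 1≢1 → ⊥-elim (1≢1 refl) ; 2F _ → refl }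

path₃-fixNumber : IsFixNumber path₃ 1
path₃-fixNumber =
  (allBut (1F ∷ 2F ∷ []) , separatingSet⇒isFixingSet {H = path₃} (from-yes (separatingSet? path₃ (allBut (1F ∷ 2F ∷ [])))) , refl) ,
  fixingSet-size-≥-by-decision {H = path₃} (transpose 0F 2F ∷ [])

-- Degrees 2, 3, 2 on A and 3, 3, 1 on B: reading allFin 6 backwards, the leaf,
-- then its neighbour, then everything else is determined.
rigidFunctigraph : Graph 6
rigidFunctigraph = functigraph path₃ λ { 0F → 0F ; 1F → 0F ; 2F → 1F }

rigidFunctigraph-fixNumber : IsFixNumber rigidFunctigraph 0
rigidFunctigraph-fixNumber =
  (⊥ , individualises⇒isFixingSet (from-yes (individualises? rigidFunctigraph (allFin 6))) ∈-allFin ⊥ , refl) ,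
  λ _ _ → z≤n

complete₃-fixNumber : IsFixNumber (complete 3) 2
complete₃-fixNumber =
  (allBut (2F ∷ []) , allBut₁-isFixingSet {H = complete 3} 2F , refl) ,
  fixingSet-size-≥-by-decision {H = complete 3} (transpose 0F 1F ∷ transpose 0F 2F ∷ transpose 1F 2F ∷ [])

constantFunctigraph : Graph 6
constantFunctigraph = functigraph (complete 3) λ _ → 0F

constantFunctigraph-fixNumber : IsFixNumber constantFunctigraph 3
constantFunctigraph-fixNumber =
  (allBut (2F ∷ 3F ∷ 5F ∷ []) ,
   separatingSet⇒isFixingSet {H = constantFunctigraph} (from-yes (separatingSet? constantFunctigraph (allBut (2F ∷ 3F ∷ 5F ∷ [])))) ,
   refl) ,
  fixingSet-size-≥-by-decision {H = constantFunctigraph}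
    (transpose 0F 1F ∷ transpose 0F 2F ∷ transpose 1F 2F ∷ transpose 4F 5F ∷ [])

mainTheorem2 :
    ((n : ℕ) (G : Graph n) (g : Fin n → Fin n) (k₁ k₂ : ℕ) →
      3 ≤ n → Connected G → Symmetric G →
      IsFixNumber G k₁ → IsFixNumber (functigraph G g) k₂ →
      (1 ≤ k₁ + k₂) × (k₁ + k₂ ≤ 3 * n ∸ 4))
    × Σ ℕ (λ n → Σ (Graph n) (λ G → Σ (Fin n → Fin n) (λ g →
        3 ≤ n × Connected G × Symmetric G ×
        Σ ℕ (λ k₁ → Σ ℕ (λ k₂ →
          IsFixNumber G k₁ × IsFixNumber (functigraph G g) k₂ × k₁ + k₂ ≡ 1)))))
    × Σ ℕ (λ n → Σ (Graph n) (λ G → Σ (Fin n → Fin n) (λ g →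
        3 ≤ n × Connected G × Symmetric G ×
        Σ ℕ (λ k₁ → Σ ℕ (λ k₂ →
          IsFixNumber G k₁ × IsFixNumber (functigraph G g) k₂ × k₁ + k₂ ≡ 3 * n ∸ 4)))))
mainTheorem2 =
  fixNumber-sum-bounds ,
  (3 , path₃ , _ , s≤s (s≤s (s≤s z≤n)) , path₃-connected , fixNumber≢0⇒symmetric {H = path₃} path₃-fixNumber ,
   1 , 0 , path₃-fixNumber , rigidFunctigraph-fixNumber , refl) ,
  (3 , complete 3 , _ , s≤s (s≤s (s≤s z≤n)) , complete-connected ,
   fixNumber≢0⇒symmetric {H = complete 3} complete₃-fixNumber ,
   2 , 3 , complete₃-fixNumber , constantFunctigraph-fixNumber , refl)
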